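{- Let $n\geq 0$ be an integer. There does not exist any set $\Phi$ of modal formulas such that, for every transitive Kripke frame $\mathcal{F}$, every formula of $\Phi$ is valid in $\mathcal{F}$ if and only if $\mathcal{F}$ has circumference at most $n$.
   Context: Modal formulas are built from propositional variables using $\top,\bot,\neg,\land,\lor,\to$ and unary modalities $\Diamond,\Box$. A (Kripke) frame is $\mathcal{F}=(W,R)$ with $R$ a binary relation on a set $W$; a formula is valid in $\mathcal{F}$ if it is true at every point of every model on $\mathcal{F}$ under the standard Kripke semantics ($\Diamond\varphi$ true at $x$ iff $\varphi$ is true at some $y$ with $xRy$). A cycle of length $m\geq 1$ in $\mathcal{F}$ is a sequence $x_1,\dots,x_m$ of distinct points with $x_1Rx_2R\cdots Rx_mRx_1$. The circumference of $\mathcal{F}$ is the supremum of the lengths of its cycles (it is $0$ if there are no cycles). -}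

module Defs where

open import Data.Nat using (ℕ; zero; suc; _≤_)
open import Data.Bool using (Bool; true)
open import Data.Fin using (Fin; zero; suc; inject₁; fromℕ)
open import Data.Product using (Σ; _×_; _,_)
open import Data.Sum using (_⊎_)
open import Data.Unit using (⊤)
open import Data.Empty using (⊥)
open import Relation.Binary.PropositionalEquality using (_≡_)
open import Function.Definitions using (Injective)

data Form : Set where
  var  : ℕ → Form
  ⊤′   : Form
  ⊥′   : Form
  ¬′_  : Form → Form
  _∧′_ : Form → Form → Form
  _∨′_ : Form → Form → Form
  _⇒′_ : Form → Form → Form
  ◇_   : Form → Form
  □_   : Form → Form

record Frame : Set₁ where
  field
    W : Set
    R : W → W → Set
open Frame public

Transitive : Frame → Set
Transitive F = ∀ {x y z} → R F x y → R F y z → R F x z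

Valuation : Frame → Set
Valuation F = ℕ → W F → Bool

_,_,_⊨_ : (F : Frame) → Valuation F → W F → Form → Set
F , V , x ⊨ var p   = V p x ≡ true
F , V , x ⊨ ⊤′      = ⊤
F , V , x ⊨ ⊥′      = ⊥
F , V , x ⊨ (¬′ φ)  = F , V , x ⊨ φ → ⊥
F , V , x ⊨ (φ ∧′ ψ) = (F , V , x ⊨ φ) × (F , V , x ⊨ ψ)
F , V , x ⊨ (φ ∨′ ψ) = (F , V , x ⊨ φ) ⊎ (F , V , x ⊨ ψ)
F , V , x ⊨ (φ ⇒′ ψ) = F , V , x ⊨ φ → F , V , x ⊨ ψ
F , V , x ⊨ (◇ φ)   = Σ (W F) λ y → R F x y × (F , V , y ⊨ φ)
F , V , x ⊨ (□ φ)   = ∀ y → R F x y → F , V , y ⊨ φ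

Valid : Frame → Form → Set
Valid F φ = ∀ (V : Valuation F) (x : W F) → F , V , x ⊨ φ

record Cycle (F : Frame) (m : ℕ) : Set where
  field
    k      : ℕ
    len    : m ≡ suc k
    pt     : Fin (suc k) → W F
    dist   : Injective _≡_ _≡_ pt
    step   : ∀ (i : Fin k) → R F (pt (inject₁ i)) (pt (suc i))
    close  : R F (pt (fromℕ k)) (pt zero)

-- Circumference ≤ n: every cycle has length at most n
-- (circumference is the supremum of cycle lengths, 0 if none).
CircumferenceAtMost : ℕ → Frame → Set
CircumferenceAtMost n F = ∀ m → Cycle F m → m ≤ n

FormSet : Set₁
FormSet = Form → Set

ValidSet : Frame → FormSet → Set
ValidSet F Φ = ∀ φ → Φ φ → Valid F φ

module Submission where

open import Defs
open import Data.Nat using (ℕ; suc; _≤_; _<_; s≤s)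
open import Data.Nat.Properties using (≤-refl; ≤-trans; <⇒≤; <-trans; n<1+n; n≮n)
open import Data.Fin using (Fin; zero; fromℕ)
open import Data.Fin.Induction using (<-weakInduction)
open import Data.Product using (Σ; _×_; _,_; proj₁; proj₂)
open import Data.Sum using (inj₁; inj₂)
open import Data.Unit using (⊤; tt)
open import Function using (_∘_)
open import Relation.Nullary using (¬_)
open import Relation.Binary.PropositionalEquality using (_≡_; refl)

-- The cluster C on n + 1 points has a cycle of length n + 1, whereas the
-- transitive chain ℕ × C of copies of C has no cycles at all.  Projecting
-- the chain onto C is a surjective p-morphism, so every formula valid on the
-- chain is valid on C.  A set Φ defining "circumference ≤ n" would be valid
-- on the chain, hence on C, forcing the circumference of C to be ≤ n.

record PMorphism (F G : Frame) : Set where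
  field
    map   : W F → W G
    forth : ∀ {x y} → R F x y → R G (map x) (map y)
    back  : ∀ {x v} → R G (map x) v → Σ (W F) λ y → R F x y × map y ≡ v

module _ {F G : Frame} (f : PMorphism F G) (V : Valuation G) where
  open PMorphism f

  pullback : Valuation F
  pullback p = V p ∘ map

  ⊨-preserve : ∀ φ x → F , pullback , x ⊨ φ → G , V , map x ⊨ φ
  ⊨-reflect  : ∀ φ x → G , V , map x ⊨ φ → F , pullback , x ⊨ φ

  ⊨-preserve (var p)  x h = h
  ⊨-preserve ⊤′       x h = h
  ⊨-preserve ⊥′       x ()
  ⊨-preserve (¬′ φ)   x h = h ∘ ⊨-reflect φ x
  ⊨-preserve (φ ∧′ ψ) x (a , b) = ⊨-preserve φ x a , ⊨-preserve ψ x b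
  ⊨-preserve (φ ∨′ ψ) x (inj₁ a) = inj₁ (⊨-preserve φ x a)
  ⊨-preserve (φ ∨′ ψ) x (inj₂ b) = inj₂ (⊨-preserve ψ x b)
  ⊨-preserve (φ ⇒′ ψ) x h = ⊨-preserve ψ x ∘ h ∘ ⊨-reflect φ x
  ⊨-preserve (◇ φ)    x (y , r , h) = map y , forth r , ⊨-preserve φ y h
  ⊨-preserve (□ φ)    x h v r with back r
  ... | y , r′ , refl = ⊨-preserve φ y (h y r′)

  ⊨-reflect (var p)  x h = h
  ⊨-reflect ⊤′       x h = h
  ⊨-reflect ⊥′       x ()
  ⊨-reflect (¬′ φ)   x h = h ∘ ⊨-preserve φ x
  ⊨-reflect (φ ∧′ ψ) x (a , b) = ⊨-reflect φ x a , ⊨-reflect ψ x b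
  ⊨-reflect (φ ∨′ ψ) x (inj₁ a) = inj₁ (⊨-reflect φ x a)
  ⊨-reflect (φ ∨′ ψ) x (inj₂ b) = inj₂ (⊨-reflect ψ x b)
  ⊨-reflect (φ ⇒′ ψ) x h = ⊨-reflect ψ x ∘ h ∘ ⊨-preserve φ x
  ⊨-reflect (◇ φ)    x (v , r , h) with back r
  ... | y , r′ , refl = y , r′ , ⊨-reflect φ y h
  ⊨-reflect (□ φ)    x h y r = ⊨-reflect φ y (h (map y) (forth r))

ValidSet-image : ∀ {F G Φ} (f : PMorphism F G) →
                 (∀ v → Σ (W F) λ x → PMorphism.map f x ≡ v) →
                 ValidSet F Φ → ValidSet G Φ
ValidSet-image f surj valid φ φ∈Φ V v with surj v
... | x , refl = ⊨-preserve f V φ x (valid φ φ∈Φ (pullback f V) x)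

Ranked : Frame → Set
Ranked F = Σ (W F → ℕ) λ rank → ∀ {x y} → R F x y → rank x < rank y

ranked⇒noCycle : ∀ {F m} → Ranked F → ¬ Cycle F m
ranked⇒noCycle (rank , increasing) c = n≮n _ (≤-trans (s≤s first≤last) (increasing close))
  where
  open Cycle c
  first≤last : rank (pt zero) ≤ rank (pt (fromℕ k))
  first≤last = <-weakInduction (λ i → rank (pt zero) ≤ rank (pt i)) ≤-refl
                 (λ i h → ≤-trans h (<⇒≤ (increasing (step i)))) (fromℕ k)

ranked⇒CircumferenceAtMost : ∀ {F} n → Ranked F → CircumferenceAtMost n F
ranked⇒CircumferenceAtMost n ranked m c with () ← ranked⇒noCycle ranked c

cluster : Set → Frame
cluster A = record { W = A ; R = λ _ _ → ⊤ }

cluster-cycle : ∀ n → Cycle (cluster (Fin (suc n))) (suc n)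
cluster-cycle n = record
  { k = n ; len = refl ; pt = λ i → i ; dist = λ e → e ; step = λ _ → tt ; close = tt }

chain : Set → Frame
chain A = record { W = ℕ × A ; R = λ x y → proj₁ x < proj₁ y }

chain-transitive : ∀ A → Transitive (chain A)
chain-transitive A = <-trans

chain-ranked : ∀ A → Ranked (chain A)
chain-ranked A = proj₁ , λ r → r

chain⇒cluster : ∀ A → PMorphism (chain A) (cluster A)
chain⇒cluster A = record
  { map   = proj₂
  ; forth = λ _ → tt
  ; back  = λ {x} {v} _ → (suc (proj₁ x) , v) , n<1+n (proj₁ x) , refl
  }

mainTheorem1 : (n : ℕ) → ¬ (Σ FormSet λ Φ → ∀ (F : Frame) → Transitive F →
                 ((ValidSet F Φ → CircumferenceAtMost n F) × (CircumferenceAtMost n F → ValidSet F Φ)))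
mainTheorem1 n (Φ , defines) = n≮n n (clusterCircumference (suc n) (cluster-cycle n))
  where
  C : Set
  C = Fin (suc n)

  -- A point of the chain is not determined by its rank, so the implicit
  -- points of transitivity cannot be inferred and are passed explicitly.
  validOnChain : ValidSet (chain C) Φ
  validOnChain = proj₂ (defines (chain C) (λ {x y z} → chain-transitive C {x} {y} {z}))
                       (ranked⇒CircumferenceAtMost n (chain-ranked C))

  validOnCluster : ValidSet (cluster C) Φ
  validOnCluster = ValidSet-image (chain⇒cluster C) (λ a → (0 , a) , refl) validOnChain

  clusterCircumference : CircumferenceAtMost n (cluster C)
  clusterCircumference = proj₁ (defines (cluster C) (λ _ _ → tt)) validOnCluster
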